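{- Fix a positive integer $k$. For each integer $f\ge1$ put $c=kf$, let $M\colon\{1,\dots,c\}\to\{1,\dots,c+f\}$ be a uniformly random injective map, and let $R_f$ be the number of requests made by the faithful man Mr.~$c+1$ (as defined in the context). Then as $f\to\infty$, $R_f$ converges in distribution to the geometric distribution $\mathrm{Ge}(1/(k+1))$, i.e. for every integer $i\ge1$, \[ \lim_{f\to\infty}\Pr(R_f=i)=\frac{1}{k+1}\Bigl(\frac{k}{k+1}\Bigr)^{i-1}. \]
   Context: Model: there are men Mr.~$1,\dots,$ Mr.~$c+f$ and women Mrs.~$1,\dots,$ Mrs.~$c+f$, Mr.~$j$ married to Mrs.~$j$. Men $1,\dots,c$ are "cheating", men $c+1,\dots,c+f$ "faithful". Mrs.~$M(j)$ is the mistress of Mr.~$j$ ($1\le j\le c$), and Mr.~$j$ is the lover of Mrs.~$M(j)$. A woman is faithful iff she is not in the image of $M$. A faithful man $m$ first asks his wife Mrs.~$m$; whenever he asks Mrs.~$w$, if $w\notin M(\{1,\dots,c\})$ she accepts and he stops, otherwise he next asks Mrs.~$M^{ -1}(w)$. His number of requests is the total number of women he asks, including the accepting one. $\mathrm{Ge}(p)$ denotes the distribution of the number of trials up to and including the first success in independent trials with success probability $p$. -}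

module Defs where

open import Data.Nat using (ℕ; zero; suc; _+_; _*_; _^_)
open import Data.Fin using (Fin; _↑ˡ_; fromℕ<; _≟_)
open import Data.Fin.Properties using (any?; all?)
open import Data.Fin.Base using () renaming (zero to fz; suc to fs)
open import Data.List using (List; []; _∷_; map; concatMap; filter; length; allFin)
open import Data.Product using (∃; _,_)
open import Data.Integer using (+_)
open import Data.Rational using (ℚ; _/_; 0ℚ)
open import Relation.Binary.PropositionalEquality using (_≡_)
open import Relation.Nullary using (Dec; yes; no)
open import Relation.Nullary.Decidable using (_→-dec_)
open import Function.Definitions using (Injective)

-- Conventions (0-based): men and women are indexed by Fin (c + f);
-- index j stands for Mr./Mrs. j+1.  Cheating men are the indices
-- j ↑ˡ f for j : Fin c.  The map M : Fin c → Fin (c + f) sends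
-- cheating man j to (the index of) his mistress.

cons : ∀ {n m} → Fin m → (Fin n → Fin m) → (Fin (suc n) → Fin m)
cons x g fz     = x
cons x g (fs i) = g i

allFuns : (n m : ℕ) → List (Fin n → Fin m)
allFuns zero    m = (λ ()) ∷ []
allFuns (suc n) m = concatMap (λ x → map (cons x) (allFuns n m)) (allFin m)

injective? : ∀ {n m} (g : Fin n → Fin m) → Dec (Injective _≡_ _≡_ g)
injective? g with all? (λ i → all? (λ j → (g i ≟ g j) →-dec (i ≟ j)))
... | yes p = yes (λ {i} {j} e → p i j e)
... | no ¬p = no (λ inj → ¬p (λ i j e → inj e))

injections : (c f : ℕ) → List (Fin c → Fin (c + f))
injections c f = filter injective? (allFuns c (c + f))

-- Number of requests made when the faithful man is currently asking Mrs. w,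
-- with a fuel bound (the chain visits distinct women, so fuel c + f + 1
-- always suffices; with zero fuel the value 0 is never reached in use).
-- If w is not in the image of M she accepts (1 request); otherwise he
-- next asks Mrs. M⁻¹(w), the wife of her lover.
requestsFrom : ∀ {c f} → (Fin c → Fin (c + f)) → ℕ → Fin (c + f) → ℕ
requestsFrom M zero       w = 0
requestsFrom {c} {f} M (suc fuel) w with any? (λ j → M j ≟ w)
... | no  _       = 1
... | yes (j , _) = suc (requestsFrom M fuel (j ↑ˡ f))

faithfulFirst : (c f : ℕ) → Fin (c + suc f)
faithfulFirst c f = fromℕ< (lemma c f)
  where
  open import Data.Nat using (_<_; s≤s; z≤n)
  open import Data.Nat.Properties using (m<m+n)
  lemma : (c f : ℕ) → c < c + suc f
  lemma c f = m<m+n c (s≤s z≤n)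

-- Number of requests R of Mr. c+1 (c = #cheating men, f+1 = #faithful men).
R : (c f : ℕ) → (Fin c → Fin (c + suc f)) → ℕ
R c f M = requestsFrom M (suc (c + suc f)) (faithfulFirst c f)

-- a / d as a rational, with the (never used) convention a / 0 = 0.
ratio : ℕ → ℕ → ℚ
ratio a zero    = 0ℚ
ratio a (suc d) = (+ a) / suc d

-- Pr(R = i) for M uniform over injective maps {1..c} → {1..c+f}, f ≥ 1
-- (the number f of faithful men is given as suc f′).
ProbR : (c f′ i : ℕ) → ℚ
ProbR c f′ i =
  ratio (length (filter (λ M → R c f′ M Data.Nat.≟ i) (injections c (suc f′))))
        (length (injections c (suc f′)))
  where import Data.Nat

geomPMF : (k i : ℕ) → ℚ
geomPMF k zero    = 0ℚ
geomPMF k (suc i) = (+ (k ^ i)) / (suc k ^ suc i)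
  where
  instance
    nz : Data.Nat.NonZero (suc k ^ suc i)
    nz = Data.Nat.Properties.m^n≢0 (suc k) (suc i)
      where import Data.Nat.Properties
  import Data.Nat

module Submission where

-- The faithful man's requests follow a chain of women: a woman who has a lover sends him on to
-- that lover's wife.  Splitting the injections M by the preimage of the woman being asked, and
-- deleting her together with her lover, turns the process for (c, c + f) into the same process
-- for (c − 1, c + f − 1).  By induction, exactly (c)_j (c + f − j − 1)_(c − j) of the (c + f)_c
-- injections give R = j + 1, where (n)_k = n (n − 1) ⋯ (n − k + 1); hence
-- Pr(R = j + 1) = (c)_j f / (c + f)_(j + 1).  For c = k f this is a ratio of polynomials in f
-- with leading coefficients k^j and (k + 1)^(j + 1), and the bounds (n − j)^j ≤ (n)_j ≤ n^j and
-- n^j − (n)_j ≤ j² n^(j − 1) make the convergence explicit: the error is below 1/q once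
-- f > j² q + j q + j.

module FallingFactorial where

  open import Data.Nat using (zero; suc; _+_; _*_; _∸_; _^_; _≤_; _>_; z<s)
  open import Data.Nat.Properties
  open import Data.Nat.Tactic.RingSolver using (solve-∀)
  open import Algebra.Properties.CommutativeSemigroup *-commutativeSemigroup using (x∙yz≈y∙xz)
  open import Relation.Binary.PropositionalEquality

  -- n P′ k = n (n − 1) ⋯ (n − k + 1) for every k: the factor n ∸ n = 0 makes it vanish for k > n.
  -- Its library precedence lies below that of _*_; it is raised so that a * n P′ k = a * (n P′ k).
  open import Data.Nat.Combinatorics.Base public using () renaming (_P′_ to infixl 8 _P′_)

  P′-suc : ∀ n k → suc n P′ suc k ≡ suc n * n P′ k
  P′-suc n zero    = refl
  P′-suc n (suc k) = trans (cong ((n ∸ k) *_) (P′-suc n k)) (x∙yz≈y∙xz (n ∸ k) (suc n) (n P′ k))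

  P′-+ : ∀ n j l → n P′ (j + l) ≡ n P′ j * (n ∸ j) P′ l
  P′-+ n j zero    = trans (cong (n P′_) (+-identityʳ j)) (sym (*-identityʳ (n P′ j)))
  P′-+ n j (suc l) = begin
    n P′ (j + suc l)                       ≡⟨ cong (n P′_) (+-suc j l) ⟩
    (n ∸ (j + l)) * n P′ (j + l)           ≡⟨ cong₂ _*_ (sym (∸-+-assoc n j l)) (P′-+ n j l) ⟩
    (n ∸ j ∸ l) * (n P′ j * (n ∸ j) P′ l)  ≡⟨ x∙yz≈y∙xz (n ∸ j ∸ l) (n P′ j) ((n ∸ j) P′ l) ⟩
    n P′ j * (n ∸ j) P′ suc l              ∎
    where open ≡-Reasoning

  P′>0 : ∀ {n j} → j ≤ n → n P′ j > 0
  P′>0 {j = zero}  _   = z<s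
  P′>0 {j = suc j} j<n = *-mono-< (m<n⇒0<n∸m j<n) (P′>0 (<⇒≤ j<n))

  P′≤^ : ∀ n j → n P′ j ≤ n ^ j
  P′≤^ n zero    = ≤-refl
  P′≤^ n (suc j) = *-mono-≤ (m∸n≤m n j) (P′≤^ n j)

  ∸^≤P′ : ∀ n j → (n ∸ j) ^ j ≤ n P′ j
  ∸^≤P′ n zero    = ≤-refl
  ∸^≤P′ n (suc j) = *-mono-≤ n∸suc-j≤n∸j (begin
    (n ∸ suc j) ^ j  ≤⟨ ^-monoˡ-≤ j n∸suc-j≤n∸j ⟩
    (n ∸ j) ^ j      ≤⟨ ∸^≤P′ n j ⟩
    n P′ j           ∎)
    where
    open ≤-Reasoning
    n∸suc-j≤n∸j : n ∸ suc j ≤ n ∸ j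
    n∸suc-j≤n∸j = ∸-monoʳ-≤ n (n≤1+n j)

  *P′≤P′-suc+ : ∀ n j → n * n P′ j ≤ n P′ suc j + j * n P′ j
  *P′≤P′-suc+ n j = begin
    n * n P′ j                     ≤⟨ *-monoˡ-≤ (n P′ j) (m≤n+m∸n n j) ⟩
    (j + (n ∸ j)) * n P′ j         ≡⟨ *-distribʳ-+ (n P′ j) j (n ∸ j) ⟩
    j * n P′ j + (n ∸ j) * n P′ j  ≡⟨ +-comm (j * n P′ j) ((n ∸ j) * n P′ j) ⟩
    n P′ suc j + j * n P′ j        ∎
    where open ≤-Reasoning

  -- n^j − (n)_j ≤ j² n^(j − 1), multiplied through by n.
  ^*≤P′*+ : ∀ n j → n ^ j * n ≤ n P′ j * n + j * j * n ^ j
  ^*≤P′*+ n zero    = m≤m+n (1 * n) 0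
  ^*≤P′*+ n (suc j) = begin
    n * n ^ j * n                                  ≡⟨ *-assoc n (n ^ j) n ⟩
    n * (n ^ j * n)                                ≤⟨ *-monoʳ-≤ n (^*≤P′*+ n j) ⟩
    n * (n P′ j * n + j * j * n ^ j)               ≡⟨ expand n (n P′ j) j (n ^ j) ⟩
    n * n P′ j * n + j * j * (n * n ^ j)           ≤⟨ +-monoˡ-≤ _ (*-monoˡ-≤ n one-factor) ⟩
    (n P′ suc j + j * n ^ j) * n + j * j * (n * n ^ j)
      ≡⟨ collect (n P′ suc j) j (n ^ j) n ⟩
    n P′ suc j * n + (j + j * j) * (n * n ^ j)     ≤⟨ +-monoʳ-≤ _ (*-monoˡ-≤ (n * n ^ j) j+j²≤[1+j]²) ⟩
    n P′ suc j * n + suc j * suc j * (n * n ^ j)   ∎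
    where
    open ≤-Reasoning
    one-factor : n * n P′ j ≤ n P′ suc j + j * n ^ j
    one-factor = ≤-trans (*P′≤P′-suc+ n j) (+-monoʳ-≤ (n P′ suc j) (*-monoʳ-≤ j (P′≤^ n j)))
    expand : ∀ n p j x → n * (p * n + j * j * x) ≡ n * p * n + j * j * (n * x)
    expand = solve-∀
    collect : ∀ p j x n → (p + j * x) * n + j * j * (n * x) ≡ p * n + (j + j * j) * (n * x)
    collect = solve-∀
    square : ∀ j → suc j + (j + j * j) ≡ suc j * suc j
    square = solve-∀
    j+j²≤[1+j]² : j + j * j ≤ suc j * suc j
    j+j²≤[1+j]² = ≤-trans (m≤n+m (j + j * j) (suc j)) (≤-reflexive (square j))

  -- Termwise (a − t) β ≤ α (b − t): a ratio bound a/b ≤ α/β ≤ 1 passes to falling factorials.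
  P′-ratio : ∀ {α β a b} j → α ≤ β → a * β ≤ α * b → a P′ j * β ^ j ≤ α ^ j * b P′ j
  P′-ratio zero    _   _ = ≤-refl
  P′-ratio {α} {β} {a} {b} (suc j) α≤β aβ≤αb = begin
    (a ∸ j) * a P′ j * (β * β ^ j)    ≡⟨ interchange (a ∸ j) (a P′ j) β (β ^ j) ⟩
    (a ∸ j) * β * (a P′ j * β ^ j)    ≤⟨ *-mono-≤ factor (P′-ratio j α≤β aβ≤αb) ⟩
    α * (b ∸ j) * (α ^ j * b P′ j)    ≡⟨ interchange α (b ∸ j) (α ^ j) (b P′ j) ⟩
    α * α ^ j * ((b ∸ j) * b P′ j)    ∎
    where
    open ≤-Reasoning
    interchange : ∀ w x y z → w * x * (y * z) ≡ w * y * (x * z)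
    interchange = solve-∀
    factor : (a ∸ j) * β ≤ α * (b ∸ j)
    factor = begin
      (a ∸ j) * β    ≡⟨ *-distribʳ-∸ β a j ⟩
      a * β ∸ j * β  ≤⟨ ∸-mono aβ≤αb (*-monoʳ-≤ j α≤β) ⟩
      α * b ∸ j * α  ≡⟨ cong (α * b ∸_) (*-comm j α) ⟩
      α * b ∸ α * j  ≡⟨ *-distribˡ-∸ α b j ⟨
      α * (b ∸ j)    ∎

module Counting where

  open import Data.Nat using (ℕ; zero; suc; _+_; _*_)
  open import Data.Nat.Properties
    using (+-identityʳ; *-identityˡ; *-zeroʳ; *-assoc; *-distribʳ-+; +-*-semiring; 0∸n≡0)
  open import Algebra.Properties.Semiring.Sum +-*-semiring
    using (sum-syntax; ∑-comm; ∑-distrib-+; *-distribʳ-sum; sum-remove; sum-cong-≗; sum-replicate-zero)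
  open import Data.Fin using (Fin; zero; suc; punchIn; punchOut; _≟_)
  open import Data.Fin.Properties
    using (punchInᵢ≢i; punchIn-injective; punchIn-punchOut; punchOut-injective; all?; any?)
  open import Data.Vec using (Vec; []; _∷_; lookup; insertAt; map)
  open import Data.Vec.Properties using (insertAt-lookup; insertAt-punchIn; lookup-map)
  import Data.List as List
  import Data.List.Properties as List
  open import Data.Nat.ListAction using () renaming (sum to ∑ˡ)
  open import Data.Nat.ListAction.Properties using () renaming (sum-++ to ∑ˡ-++)
  open import Data.Empty using (⊥-elim)
  open import Data.Product using (_×_; _,_)
  open import Function using (_∘_; id)
  open import Function.Bundles using (_⇔_; mk⇔; Equivalence)
  open import Function.Definitions using (Injective)
  open import Relation.Nullary using (Dec; yes; no; ¬_; ¬?; contradiction; _×-dec_)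
  open import Relation.Unary using (Decidable)
  open import Relation.Binary.PropositionalEquality
  open import Defs using (cons; allFuns; injective?)
  open FallingFactorial

  𝟙 : ∀ {p} {P : Set p} → Dec P → ℕ
  𝟙 (yes _) = 1
  𝟙 (no _)  = 0

  module _ {p q} {P : Set p} {Q : Set q} where

    𝟙-cong : P ⇔ Q → (P? : Dec P) (Q? : Dec Q) → 𝟙 P? ≡ 𝟙 Q?
    𝟙-cong P⇔Q (yes _) (yes _) = refl
    𝟙-cong P⇔Q (yes p) (no ¬q) = contradiction (Equivalence.to P⇔Q p) ¬q
    𝟙-cong P⇔Q (no ¬p) (yes q) = contradiction (Equivalence.from P⇔Q q) ¬p
    𝟙-cong P⇔Q (no _)  (no _)  = refl

    𝟙-× : (P? : Dec P) (Q? : Dec Q) → 𝟙 (P? ×-dec Q?) ≡ 𝟙 P? * 𝟙 Q?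
    𝟙-× (yes _) (yes _) = refl
    𝟙-× (yes _) (no _)  = refl
    𝟙-× (no _)  _       = refl

  𝟙-yes : ∀ {p} {P : Set p} (P? : Dec P) → P → 𝟙 P? ≡ 1
  𝟙-yes (yes _) p = refl
  𝟙-yes (no ¬p) p = contradiction p ¬p

  𝟙-no : ∀ {p} {P : Set p} (P? : Dec P) → ¬ P → 𝟙 P? ≡ 0
  𝟙-no (yes p) ¬p = contradiction p ¬p
  𝟙-no (no _)  ¬p = refl

  ∑-const : ∀ n c → ∑[ _ < n ] c ≡ n * c
  ∑-const zero    c = refl
  ∑-const (suc n) c = cong (c +_) (∑-const n c)

  ∑-single : ∀ {m} (w : Fin m) (g : Fin m → ℕ) → (∀ x → x ≢ w → g x ≡ 0) → ∑[ x < m ] g x ≡ g w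
  ∑-single {suc m} w g g≡0 = begin
    ∑[ x < suc m ] g x                ≡⟨ sum-remove {i = w} g ⟩
    g w + ∑[ x < m ] g (punchIn w x)  ≡⟨ cong (g w +_) (sum-cong-≗ (λ x → g≡0 _ (punchInᵢ≢i w x))) ⟩
    g w + ∑[ x < m ] 0                ≡⟨ cong (g w +_) (sum-replicate-zero m) ⟩
    g w + 0                           ≡⟨ +-identityʳ (g w) ⟩
    g w                               ∎
    where open ≡-Reasoning

  -- A sum over all maps Fin n → Fin m, each given by the vector of its values.
  ∑ᵛ : ∀ n {m} → (Vec (Fin m) n → ℕ) → ℕ
  ∑ᵛ zero        φ = φ []
  ∑ᵛ (suc n) {m} φ = ∑[ x < m ] ∑ᵛ n (λ v → φ (x ∷ v))

  ∑ᵛ-cong : ∀ n {m} {φ ψ : Vec (Fin m) n → ℕ} → (∀ v → φ v ≡ ψ v) → ∑ᵛ n φ ≡ ∑ᵛ n ψ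
  ∑ᵛ-cong zero    φ≡ψ = φ≡ψ []
  ∑ᵛ-cong (suc n) φ≡ψ = sum-cong-≗ (λ x → ∑ᵛ-cong n (λ v → φ≡ψ (x ∷ v)))

  ∑ᵛ-zero : ∀ n {m} {φ : Vec (Fin m) n → ℕ} → (∀ v → φ v ≡ 0) → ∑ᵛ n φ ≡ 0
  ∑ᵛ-zero zero        φ≡0 = φ≡0 []
  ∑ᵛ-zero (suc n) {m} φ≡0 =
    trans (sum-cong-≗ (λ x → ∑ᵛ-zero n (λ v → φ≡0 (x ∷ v)))) (sum-replicate-zero m)

  ∑ᵛ-+ : ∀ n {m} (φ ψ : Vec (Fin m) n → ℕ) → ∑ᵛ n (λ v → φ v + ψ v) ≡ ∑ᵛ n φ + ∑ᵛ n ψ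
  ∑ᵛ-+ zero    φ ψ = refl
  ∑ᵛ-+ (suc n) φ ψ = trans (sum-cong-≗ (λ x → ∑ᵛ-+ n (λ v → φ (x ∷ v)) (λ v → ψ (x ∷ v))))
                           (∑-distrib-+ (λ x → ∑ᵛ n (λ v → φ (x ∷ v))) (λ x → ∑ᵛ n (λ v → ψ (x ∷ v))))

  ∑ᵛ-∑ : ∀ n {m a} (φ : Fin a → Vec (Fin m) n → ℕ) →
         ∑ᵛ n (λ v → ∑[ j < a ] φ j v) ≡ ∑[ j < a ] ∑ᵛ n (φ j)
  ∑ᵛ-∑ zero    φ = refl
  ∑ᵛ-∑ (suc n) φ = trans (sum-cong-≗ (λ x → ∑ᵛ-∑ n (λ j v → φ j (x ∷ v))))
                         (∑-comm (λ x j → ∑ᵛ n (λ v → φ j (x ∷ v))))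

  ∑ᵛ-insertAt : ∀ {n m} (j : Fin (suc n)) (φ : Vec (Fin m) (suc n) → ℕ) →
                ∑ᵛ (suc n) φ ≡ ∑[ x < m ] ∑ᵛ n (λ u → φ (insertAt u j x))
  ∑ᵛ-insertAt         zero    φ = refl
  ∑ᵛ-insertAt {suc n} (suc j) φ =
    trans (sum-cong-≗ (λ y → ∑ᵛ-insertAt j (λ v → φ (y ∷ v))))
          (∑-comm (λ y x → ∑ᵛ n (λ u → φ (y ∷ insertAt u j x))))

  ∑ᵛ-lookup≡ : ∀ {n m} (j : Fin (suc n)) (w : Fin m) (φ : Vec (Fin m) (suc n) → ℕ) →
               ∑ᵛ (suc n) (λ v → 𝟙 (lookup v j ≟ w) * φ v) ≡ ∑ᵛ n (λ u → φ (insertAt u j w))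
  ∑ᵛ-lookup≡ {n} {m} j w φ = begin
    ∑ᵛ (suc n) (λ v → 𝟙 (lookup v j ≟ w) * φ v)
      ≡⟨ ∑ᵛ-insertAt j (λ v → 𝟙 (lookup v j ≟ w) * φ v) ⟩
    ∑[ x < m ] ∑ᵛ n (λ u → 𝟙 (lookup (insertAt u j x) j ≟ w) * φ (insertAt u j x))
      ≡⟨ ∑-single w _ (λ x x≢w → ∑ᵛ-zero n (λ u → cong (_* φ (insertAt u j x))
           (𝟙-no (lookup (insertAt u j x) j ≟ w) (x≢w ∘ trans (sym (insertAt-lookup u j x)))))) ⟩
    ∑ᵛ n (λ u → 𝟙 (lookup (insertAt u j w) j ≟ w) * φ (insertAt u j w))
      ≡⟨ ∑ᵛ-cong n (λ u → trans (cong (_* φ (insertAt u j w))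
           (𝟙-yes (lookup (insertAt u j w) j ≟ w) (insertAt-lookup u j w))) (*-identityˡ _)) ⟩
    ∑ᵛ n (λ u → φ (insertAt u j w))
      ∎
    where open ≡-Reasoning

  Avoids : ∀ {n m} → Vec (Fin m) n → Fin m → Set
  Avoids v w = ∀ t → lookup v t ≢ w

  avoids? : ∀ {n m} (v : Vec (Fin m) n) (w : Fin m) → Dec (Avoids v w)
  avoids? v w = all? (λ t → ¬? (lookup v t ≟ w))

  Avoids-∷ : ∀ {n m} {x w : Fin m} {v : Vec (Fin m) n} → x ≢ w → Avoids (x ∷ v) w ⇔ Avoids v w
  Avoids-∷ {x = x} {w} {v} x≢w = mk⇔ (λ av t → av (suc t)) extend
    where
    extend : Avoids v w → Avoids (x ∷ v) w
    extend av zero    = x≢w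
    extend av (suc t) = av t

  punchIn-avoids : ∀ {n m} (u : Vec (Fin m) n) (w : Fin (suc m)) → Avoids (map (punchIn w) u) w
  punchIn-avoids u w t eq = punchInᵢ≢i w (lookup u t) (trans (sym (lookup-map t (punchIn w) u)) eq)

  ∑ᵛ-avoid : ∀ n {m} (w : Fin (suc m)) (φ : Vec (Fin (suc m)) n → ℕ) →
             ∑ᵛ n (λ v → 𝟙 (avoids? v w) * φ v) ≡ ∑ᵛ n (λ u → φ (map (punchIn w) u))
  ∑ᵛ-avoid zero        w φ = trans (cong (_* φ []) (𝟙-yes (avoids? [] w) (λ ()))) (*-identityˡ (φ []))
  ∑ᵛ-avoid (suc n) {m} w φ = begin
    ∑[ x < suc m ] A x
      ≡⟨ sum-remove {i = w} A ⟩
    A w + ∑[ x < m ] A (punchIn w x)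
      ≡⟨ cong₂ _+_ A[w]≡0 (sum-cong-≗ A∘punchIn) ⟩
    ∑[ x < m ] ∑ᵛ n (λ v → 𝟙 (avoids? v w) * φ (punchIn w x ∷ v))
      ≡⟨ sum-cong-≗ (λ x → ∑ᵛ-avoid n w (λ v → φ (punchIn w x ∷ v))) ⟩
    ∑[ x < m ] ∑ᵛ n (λ u → φ (punchIn w x ∷ map (punchIn w) u))
      ∎
    where
    open ≡-Reasoning
    A : Fin (suc m) → ℕ
    A x = ∑ᵛ n (λ v → 𝟙 (avoids? (x ∷ v) w) * φ (x ∷ v))
    A[w]≡0 : A w ≡ 0
    A[w]≡0 = ∑ᵛ-zero n (λ v → cong (_* φ (w ∷ v)) (𝟙-no (avoids? (w ∷ v) w) (λ av → av zero refl)))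
    A∘punchIn : ∀ x → A (punchIn w x) ≡ ∑ᵛ n (λ v → 𝟙 (avoids? v w) * φ (punchIn w x ∷ v))
    A∘punchIn x = ∑ᵛ-cong n (λ v → cong (_* φ (punchIn w x ∷ v))
      (𝟙-cong (Avoids-∷ (punchInᵢ≢i w x)) (avoids? (punchIn w x ∷ v) w) (avoids? v w)))

  injective-≗ : ∀ {n m} {g h : Fin n → Fin m} → Injective _≡_ _≡_ g → g ≗ h → Injective _≡_ _≡_ h
  injective-≗ g-inj g≗h {s} {t} hs≡ht = g-inj (trans (g≗h s) (trans hs≡ht (sym (g≗h t))))

  injective-cong : ∀ {n m} {g h : Fin n → Fin m} → g ≗ h → Injective _≡_ _≡_ g ⇔ Injective _≡_ _≡_ h
  injective-cong {g = g} {h} g≗h = mk⇔ {A = Injective _≡_ _≡_ g} {B = Injective _≡_ _≡_ h}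
    (λ inj → injective-≗ inj g≗h) (λ inj → injective-≗ inj (sym ∘ g≗h))

  injective-[] : ∀ {m} → Injective _≡_ _≡_ (lookup {A = Fin m} [])
  injective-[] {x = ()}

  injective-insertAt : ∀ {n m} (u : Vec (Fin m) n) (j : Fin (suc n)) (w : Fin m) →
                       Injective _≡_ _≡_ (lookup (insertAt u j w))
                       ⇔ (Avoids u w × Injective _≡_ _≡_ (lookup u))
  injective-insertAt {n} {m} u j w = mk⇔ split join
    where
    g : Fin (suc n) → Fin m
    g = lookup (insertAt u j w)
    g∘punchIn : ∀ t → g (punchIn j t) ≡ lookup u t
    g∘punchIn = insertAt-punchIn u j w
    g-off-j : ∀ {y} (j≢y : j ≢ y) → g y ≡ lookup u (punchOut j≢y)
    g-off-j j≢y = trans (cong g (sym (punchIn-punchOut j≢y))) (g∘punchIn _)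
    hits-w : ∀ {y} (j≢y : j ≢ y) → g y ≡ g j → lookup u (punchOut j≢y) ≡ w
    hits-w j≢y gy≡gj = trans (sym (g-off-j j≢y)) (trans gy≡gj (insertAt-lookup u j w))
    split : Injective _≡_ _≡_ g → Avoids u w × Injective _≡_ _≡_ (lookup u)
    split inj =
      (λ t ut≡w → punchInᵢ≢i j t (inj (trans (g∘punchIn t) (trans ut≡w (sym (insertAt-lookup u j w))))))
      , (λ {s} {t} us≡ut → punchIn-injective j s t
                             (inj (trans (g∘punchIn s) (trans us≡ut (sym (g∘punchIn t))))))
    join : Avoids u w × Injective _≡_ _≡_ (lookup u) → Injective _≡_ _≡_ g
    join (av , inj) {x} {y} gx≡gy with j ≟ x | j ≟ y
    ... | yes refl | yes refl = refl
    ... | yes refl | no j≢y   = contradiction (hits-w j≢y (sym gx≡gy)) (av _)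
    ... | no j≢x   | yes refl = contradiction (hits-w j≢x gx≡gy) (av _)
    ... | no j≢x   | no j≢y   =
      punchOut-injective j≢x j≢y (inj (trans (sym (g-off-j j≢x)) (trans gx≡gy (g-off-j j≢y))))

  injective-map : ∀ {n m m′} {f : Fin m → Fin m′} (u : Vec (Fin m) n) → Injective _≡_ _≡_ f →
                  Injective _≡_ _≡_ (lookup (map f u)) ⇔ Injective _≡_ _≡_ (lookup u)
  injective-map {f = f} u f-inj = mk⇔
    (λ inj {s} {t} us≡ut → inj (trans (lookup-map s f u) (trans (cong f us≡ut) (sym (lookup-map t f u)))))
    (λ inj {s} {t} fus≡fut → inj (f-inj (trans (sym (lookup-map s f u)) (trans fus≡fut (lookup-map t f u)))))

  𝟙-injective-insertAt : ∀ {n m} (u : Vec (Fin m) n) (j : Fin (suc n)) (w : Fin m) (x : ℕ) →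
    𝟙 (injective? (lookup (insertAt u j w))) * x ≡ 𝟙 (avoids? u w) * (𝟙 (injective? (lookup u)) * x)
  𝟙-injective-insertAt u j w x = begin
    𝟙 (injective? (lookup (insertAt u j w))) * x
      ≡⟨ cong (_* x) (𝟙-cong (injective-insertAt u j w) (injective? _)
                             (avoids? u w ×-dec injective? (lookup u))) ⟩
    𝟙 (avoids? u w ×-dec injective? (lookup u)) * x
      ≡⟨ cong (_* x) (𝟙-× (avoids? u w) (injective? (lookup u))) ⟩
    𝟙 (avoids? u w) * 𝟙 (injective? (lookup u)) * x
      ≡⟨ *-assoc (𝟙 (avoids? u w)) (𝟙 (injective? (lookup u))) x ⟩
    𝟙 (avoids? u w) * (𝟙 (injective? (lookup u)) * x)
      ∎
    where open ≡-Reasoning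

  ∑ⁱ : ∀ n {m} → (Vec (Fin m) n → ℕ) → ℕ
  ∑ⁱ n φ = ∑ᵛ n (λ v → 𝟙 (injective? (lookup v)) * φ v)

  ∑ⁱ-cong : ∀ n {m} {φ ψ : Vec (Fin m) n → ℕ} → (∀ v → Injective _≡_ _≡_ (lookup v) → φ v ≡ ψ v) →
            ∑ⁱ n φ ≡ ∑ⁱ n ψ
  ∑ⁱ-cong n {φ = φ} {ψ} φ≡ψ = ∑ᵛ-cong n (λ v → on-injective v (injective? (lookup v)))
    where
    on-injective : ∀ v (inj? : Dec (Injective _≡_ _≡_ (lookup v))) → 𝟙 inj? * φ v ≡ 𝟙 inj? * ψ v
    on-injective v (yes inj) = cong (1 *_) (φ≡ψ v inj)
    on-injective v (no _)    = refl

  ∑ⁱ-zero : ∀ n {m} → ∑ⁱ n {m} (λ _ → 0) ≡ 0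
  ∑ⁱ-zero n = ∑ᵛ-zero n (λ v → *-zeroʳ (𝟙 (injective? (lookup v))))

  ∑ⁱ-avoid : ∀ n {m} (w : Fin (suc m)) (φ : Vec (Fin (suc m)) n → ℕ) →
             ∑ᵛ n (λ v → 𝟙 (avoids? v w) * (𝟙 (injective? (lookup v)) * φ v))
             ≡ ∑ⁱ n (λ u → φ (map (punchIn w) u))
  ∑ⁱ-avoid n w φ = trans (∑ᵛ-avoid n w (λ v → 𝟙 (injective? (lookup v)) * φ v)) (∑ᵛ-cong n λ u →
    cong (_* φ (map (punchIn w) u))
         (𝟙-cong (injective-map u (punchIn-injective w _ _)) (injective? _) (injective? (lookup u))))

  count-injective : ∀ n m → ∑ⁱ n {m} (λ _ → 1) ≡ m P′ n
  count-injective zero    m       = 𝟙-yes (injective? (lookup {A = Fin m} [])) injective-[]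
  count-injective (suc n) zero    = sym (cong (_* zero P′ n) (0∸n≡0 n))
  count-injective (suc n) (suc m) = begin
    ∑[ x < suc m ] ∑ᵛ n (λ v → 𝟙 (injective? (lookup (x ∷ v))) * 1)
      ≡⟨ sum-cong-≗ (λ x → ∑ᵛ-cong n (λ v → 𝟙-injective-insertAt v zero x 1)) ⟩
    ∑[ x < suc m ] ∑ᵛ n (λ v → 𝟙 (avoids? v x) * (𝟙 (injective? (lookup v)) * 1))
      ≡⟨ sum-cong-≗ (λ x → ∑ⁱ-avoid n x (λ _ → 1)) ⟩
    ∑[ x < suc m ] ∑ⁱ n {m} (λ _ → 1)  ≡⟨ sum-cong-≗ {suc m} (λ _ → count-injective n m) ⟩
    ∑[ x < suc m ] (m P′ n)            ≡⟨ ∑-const (suc m) (m P′ n) ⟩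
    suc m * m P′ n                     ≡⟨ P′-suc m n ⟨
    suc m P′ suc n                     ∎
    where open ≡-Reasoning

  𝟙-partition : ∀ {n m} (v : Vec (Fin m) n) (w : Fin m) → Injective _≡_ _≡_ (lookup v) →
                𝟙 (avoids? v w) + ∑[ j < n ] 𝟙 (lookup v j ≟ w) ≡ 1
  𝟙-partition {n} v w inj with any? (λ j → lookup v j ≟ w)
  ... | yes (j , vj≡w) = cong₂ _+_ (𝟙-no (avoids? v w) (λ av → av j vj≡w)) (begin
    ∑[ x < n ] 𝟙 (lookup v x ≟ w)
      ≡⟨ ∑-single j _ (λ x x≢j → 𝟙-no (lookup v x ≟ w) (λ vx≡w → x≢j (inj (trans vx≡w (sym vj≡w))))) ⟩
    𝟙 (lookup v j ≟ w)  ≡⟨ 𝟙-yes (lookup v j ≟ w) vj≡w ⟩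
    1                   ∎)
    where open ≡-Reasoning
  ... | no ¬hit = cong₂ _+_ (𝟙-yes (avoids? v w) (λ t vt≡w → ¬hit (t , vt≡w)))
    (trans (sum-cong-≗ (λ t → 𝟙-no (lookup v t ≟ w) (λ vt≡w → ¬hit (t , vt≡w)))) (sum-replicate-zero n))

  *-partition : ∀ {n m} (v : Vec (Fin m) n) (w : Fin m) (x : ℕ) → let y = 𝟙 (injective? (lookup v)) * x in
                y ≡ 𝟙 (avoids? v w) * y + ∑[ j < n ] (𝟙 (lookup v j ≟ w) * y)
  *-partition {n} v w x = begin
    y                                                           ≡⟨ on-injective (injective? (lookup v)) ⟩
    (𝟙 (avoids? v w) + ∑[ j < n ] 𝟙 (lookup v j ≟ w)) * y      ≡⟨ *-distribʳ-+ y (𝟙 (avoids? v w)) _ ⟩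
    𝟙 (avoids? v w) * y + (∑[ j < n ] 𝟙 (lookup v j ≟ w)) * y
      ≡⟨ cong (𝟙 (avoids? v w) * y +_) (*-distribʳ-sum y (λ j → 𝟙 (lookup v j ≟ w))) ⟩
    𝟙 (avoids? v w) * y + ∑[ j < n ] (𝟙 (lookup v j ≟ w) * y)  ∎
    where
    open ≡-Reasoning
    y = 𝟙 (injective? (lookup v)) * x
    on-injective : (inj? : Dec (Injective _≡_ _≡_ (lookup v))) →
                   𝟙 inj? * x ≡ (𝟙 (avoids? v w) + ∑[ j < n ] 𝟙 (lookup v j ≟ w)) * (𝟙 inj? * x)
    on-injective (yes inj) = sym (trans (cong (_* (1 * x)) (𝟙-partition v w inj)) (*-identityˡ (1 * x)))
    on-injective (no _)    = sym (*-zeroʳ (𝟙 (avoids? v w) + ∑[ j < n ] 𝟙 (lookup v j ≟ w)))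

  -- An injection into Fin (suc m) either avoids w or sends exactly one j to w.
  ∑ⁱ-split : ∀ n {m} (w : Fin (suc m)) (φ : Vec (Fin (suc m)) (suc n) → ℕ) →
             ∑ⁱ (suc n) φ ≡ ∑ⁱ (suc n) (λ u → φ (map (punchIn w) u))
                            + ∑[ j < suc n ] ∑ⁱ n (λ u → φ (insertAt (map (punchIn w) u) j w))
  ∑ⁱ-split n {m} w φ = begin
    ∑ⁱ (suc n) φ
      ≡⟨ ∑ᵛ-cong (suc n) (λ v → *-partition v w (φ v)) ⟩
    ∑ᵛ (suc n) (λ v → 𝟙 (avoids? v w) * ι v + ∑[ j < suc n ] (𝟙 (lookup v j ≟ w) * ι v))
      ≡⟨ ∑ᵛ-+ (suc n) (λ v → 𝟙 (avoids? v w) * ι v) (λ v → ∑[ j < suc n ] (𝟙 (lookup v j ≟ w) * ι v)) ⟩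
    ∑ᵛ (suc n) (λ v → 𝟙 (avoids? v w) * ι v)
      + ∑ᵛ (suc n) (λ v → ∑[ j < suc n ] (𝟙 (lookup v j ≟ w) * ι v))
      ≡⟨ cong₂ _+_ (∑ⁱ-avoid (suc n) w φ) (∑ᵛ-∑ (suc n) (λ j v → 𝟙 (lookup v j ≟ w) * ι v)) ⟩
    avoiding + ∑[ j < suc n ] ∑ᵛ (suc n) (λ v → 𝟙 (lookup v j ≟ w) * ι v)
      ≡⟨ cong (avoiding +_) (sum-cong-≗ λ j → trans (∑ᵛ-lookup≡ j w ι)
           (∑ᵛ-cong n λ u → 𝟙-injective-insertAt u j w (φ (insertAt u j w)))) ⟩
    avoiding
      + ∑[ j < suc n ] ∑ᵛ n (λ u → 𝟙 (avoids? u w) * (𝟙 (injective? (lookup u)) * φ (insertAt u j w)))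
      ≡⟨ cong (avoiding +_) (sum-cong-≗ λ j → ∑ⁱ-avoid n w (λ u → φ (insertAt u j w))) ⟩
    avoiding + ∑[ j < suc n ] ∑ⁱ n (λ u → φ (insertAt (map (punchIn w) u) j w))
      ∎
    where
    open ≡-Reasoning
    ι : Vec (Fin (suc m)) (suc n) → ℕ
    ι v = 𝟙 (injective? (lookup v)) * φ v
    avoiding : ℕ
    avoiding = ∑ⁱ (suc n) (λ u → φ (map (punchIn w) u))

  length-filter≡∑𝟙 : ∀ {A : Set} {P : A → Set} (P? : Decidable P) (xs : List.List A) →
                  List.length (List.filter P? xs) ≡ ∑ˡ (List.map (𝟙 ∘ P?) xs)
  length-filter≡∑𝟙 P? List.[]       = refl
  length-filter≡∑𝟙 P? (x List.∷ xs) with P? x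
  ... | yes _ = cong suc (length-filter≡∑𝟙 P? xs)
  ... | no  _ = length-filter≡∑𝟙 P? xs

  ∑ˡ-filter : ∀ {A : Set} {P : A → Set} (P? : Decidable P) (φ : A → ℕ) (xs : List.List A) →
              ∑ˡ (List.map φ (List.filter P? xs)) ≡ ∑ˡ (List.map (λ x → 𝟙 (P? x) * φ x) xs)
  ∑ˡ-filter P? φ List.[]       = refl
  ∑ˡ-filter P? φ (x List.∷ xs) with P? x
  ... | yes _ = cong₂ _+_ (sym (+-identityʳ (φ x))) (∑ˡ-filter P? φ xs)
  ... | no  _ = ∑ˡ-filter P? φ xs

  ∑ˡ-concatMap-tabulate : ∀ {A B : Set} m (g : Fin m → B) (F : B → List.List A) (φ : A → ℕ) →
    ∑ˡ (List.map φ (List.concatMap F (List.tabulate g))) ≡ ∑[ x < m ] ∑ˡ (List.map φ (F (g x)))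
  ∑ˡ-concatMap-tabulate zero    g F φ = refl
  ∑ˡ-concatMap-tabulate {A} (suc m) g F φ = begin
    ∑ˡ (List.map φ (F (g zero) List.++ rest))
      ≡⟨ cong ∑ˡ (List.map-++ φ (F (g zero)) rest) ⟩
    ∑ˡ (List.map φ (F (g zero)) List.++ List.map φ rest)
      ≡⟨ ∑ˡ-++ (List.map φ (F (g zero))) (List.map φ rest) ⟩
    ∑ˡ (List.map φ (F (g zero))) + ∑ˡ (List.map φ rest)
      ≡⟨ cong (∑ˡ (List.map φ (F (g zero))) +_) (∑ˡ-concatMap-tabulate m (g ∘ suc) F φ) ⟩
    ∑[ x < suc m ] ∑ˡ (List.map φ (F (g x)))
      ∎
    where
    open ≡-Reasoning
    rest : List.List A
    rest = List.concatMap F (List.tabulate (g ∘ suc))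

  ∑ˡ-allFuns : ∀ n m (φ : (Fin n → Fin m) → ℕ) → (∀ {g h} → g ≗ h → φ g ≡ φ h) →
               ∑ˡ (List.map φ (allFuns n m)) ≡ ∑ᵛ n (λ v → φ (lookup v))
  ∑ˡ-allFuns zero    m φ φ-cong = trans (+-identityʳ _) (φ-cong λ ())
  ∑ˡ-allFuns (suc n) m φ φ-cong = begin
    ∑ˡ (List.map φ (allFuns (suc n) m))
      ≡⟨ ∑ˡ-concatMap-tabulate m id (λ x → List.map (cons x) (allFuns n m)) φ ⟩
    ∑[ x < m ] ∑ˡ (List.map φ (List.map (cons x) (allFuns n m)))
      ≡⟨ sum-cong-≗ {m} (λ x → cong ∑ˡ (sym (List.map-∘ {g = φ} {f = cons x} (allFuns n m)))) ⟩
    ∑[ x < m ] ∑ˡ (List.map (φ ∘ cons x) (allFuns n m))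
      ≡⟨ sum-cong-≗ (λ x → ∑ˡ-allFuns n m (φ ∘ cons x) (φ-cong ∘ cons-cong x)) ⟩
    ∑[ x < m ] ∑ᵛ n (λ v → φ (cons x (lookup v)))
      ≡⟨ sum-cong-≗ (λ x → ∑ᵛ-cong n (λ v → φ-cong (cons-lookup x v))) ⟩
    ∑ᵛ (suc n) (λ v → φ (lookup v))
      ∎
    where
    open ≡-Reasoning
    cons-cong : ∀ x {g h : Fin n → Fin m} → g ≗ h → cons x g ≗ cons x h
    cons-cong x g≗h zero    = refl
    cons-cong x g≗h (suc t) = g≗h t
    cons-lookup : ∀ x v → cons x (lookup v) ≗ lookup (x ∷ v)
    cons-lookup x v zero    = refl
    cons-lookup x v (suc t) = refl

  ∑ˡ-injections : ∀ n m (ψ : (Fin n → Fin m) → ℕ) →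
                  (∀ {g h} → Injective _≡_ _≡_ g → g ≗ h → ψ g ≡ ψ h) →
                  ∑ˡ (List.map ψ (List.filter injective? (allFuns n m))) ≡ ∑ⁱ n (λ v → ψ (lookup v))
  ∑ˡ-injections n m ψ ψ-cong =
    trans (∑ˡ-filter injective? ψ (allFuns n m))
          (∑ˡ-allFuns n m (λ g → 𝟙 (injective? g) * ψ g) weighted-cong)
    where
    weighted-cong : ∀ {g h} → g ≗ h → 𝟙 (injective? g) * ψ g ≡ 𝟙 (injective? h) * ψ h
    weighted-cong {g} {h} g≗h with injective? g | injective? h
    ... | yes g-inj | yes _     = cong (1 *_) (ψ-cong g-inj g≗h)
    ... | yes g-inj | no ¬h-inj = ⊥-elim (¬h-inj (injective-≗ g-inj g≗h))
    ... | no ¬g-inj | yes h-inj = ⊥-elim (¬g-inj (injective-≗ h-inj (sym ∘ g≗h)))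
    ... | no _      | no _      = refl

module Requests where

  open import Data.Nat using (ℕ; zero; suc; _+_; _*_; _∸_; _<_; s≤s)
  import Data.Nat as ℕ
  open import Data.Nat.Properties
    using (+-identityʳ; *-identityˡ; *-identityʳ; *-assoc; 0∸n≡0; suc-injective; m≤m+n; <-irrefl)
  open import Algebra.Properties.Semiring.Sum Data.Nat.Properties.+-*-semiring
    using (sum-syntax; sum-cong-≗; sum-replicate-zero)
  open import Data.Fin using (Fin; zero; suc; punchIn; punchOut; _≟_; _↑ˡ_; toℕ)
  open import Data.Fin.Properties
    using (punchInᵢ≢i; punchIn-injective; punchIn-punchOut; punchOut-punchIn; punchOut-cong; punchOut-injective;
           any?; ↑ˡ-injective; toℕ-↑ˡ; toℕ-fromℕ<; toℕ<n)
  open import Data.Vec using (Vec; []; lookup; insertAt; map)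
  open import Data.Vec.Properties using (insertAt-lookup; insertAt-punchIn; lookup-map)
  import Data.List as List
  open import Data.Nat.ListAction using () renaming (sum to ∑ˡ)
  open import Data.Product using (_,_)
  open import Function using (_∘_)
  open import Function.Bundles using (mk⇔; Equivalence)
  open import Function.Definitions using (Injective)
  open import Relation.Nullary using (Dec; yes; no; contradiction)
  open import Relation.Binary.PropositionalEquality
  open import Defs using (injective?; requestsFrom; R; faithfulFirst; allFuns; injections)
  open FallingFactorial
  open Counting

  -- Defs.requestsFrom with the wives of the cheating men given by an arbitrary map, so that the
  -- process keeps its shape when a man and his mistress are deleted and the rest relabelled.
  requests : ∀ {a m} → (Fin a → Fin m) → (Fin a → Fin m) → ℕ → Fin m → ℕ
  requests wife M zero       w = 0
  requests wife M (suc fuel) w with any? (λ j → M j ≟ w)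
  ... | no  _       = 1
  ... | yes (j , _) = suc (requests wife M fuel (wife j))

  requestsFrom≡requests : ∀ {c f} (M : Fin c → Fin (c + f)) fuel w →
                          requestsFrom M fuel w ≡ requests (_↑ˡ f) M fuel w
  requestsFrom≡requests M zero       w = refl
  requestsFrom≡requests {f = f} M (suc fuel) w with any? (λ j → M j ≟ w)
  ... | no  _       = refl
  ... | yes (j , _) = cong suc (requestsFrom≡requests M fuel (j ↑ˡ f))

  module _ {a m} (wife : Fin a → Fin m) where

    requests-avoid : ∀ {M : Fin a → Fin m} {w} fuel → (∀ j → M j ≢ w) → requests wife M (suc fuel) w ≡ 1
    requests-avoid {M} {w} fuel av with any? (λ j → M j ≟ w)
    ... | no  _          = refl
    ... | yes (j , Mj≡w) = contradiction Mj≡w (av j)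

    requests-hit : ∀ {M : Fin a → Fin m} {w} fuel → Injective _≡_ _≡_ M → ∀ {j} → M j ≡ w →
                   requests wife M (suc fuel) w ≡ suc (requests wife M fuel (wife j))
    requests-hit {M} {w} fuel inj Mj≡w with any? (λ j → M j ≟ w)
    ... | no  ¬hit         = contradiction (_ , Mj≡w) ¬hit
    ... | yes (j′ , Mj′≡w) = cong (λ t → suc (requests wife M fuel (wife t))) (inj (trans Mj′≡w (sym Mj≡w)))

    requests-suc≢0 : ∀ (M : Fin a → Fin m) fuel w → requests wife M (suc fuel) w ≢ 0
    requests-suc≢0 M fuel w with any? (λ j → M j ≟ w)
    ... | no  _ = λ ()
    ... | yes _ = λ ()

    requests-cong : ∀ {M M′ : Fin a → Fin m} → Injective _≡_ _≡_ M → M ≗ M′ →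
                    ∀ fuel w → requests wife M fuel w ≡ requests wife M′ fuel w
    requests-cong inj M≗M′ zero w = refl
    requests-cong {M} {M′} inj M≗M′ (suc fuel) w with any? (λ j → M j ≟ w) | any? (λ j → M′ j ≟ w)
    ... | yes (j , Mj≡w) | yes (j′ , M′j′≡w) = cong suc (trans
      (cong (λ t → requests wife M fuel (wife t)) (inj (trans Mj≡w (sym (trans (M≗M′ j′) M′j′≡w)))))
      (requests-cong inj M≗M′ fuel (wife j′)))
    ... | yes (j , Mj≡w) | no ¬hit′          = contradiction (j , trans (sym (M≗M′ j)) Mj≡w) ¬hit′
    ... | no ¬hit        | yes (j′ , M′j′≡w) = contradiction (j′ , trans (M≗M′ j′) M′j′≡w) ¬hit
    ... | no _           | no _              = refl

  requests-relabel : ∀ {a m} {wife M : Fin (suc a) → Fin (suc m)} {wife′ M′ : Fin a → Fin m} {j w} →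
    Injective _≡_ _≡_ M → M j ≡ w → (∀ t → M (punchIn j t) ≡ punchIn w (M′ t)) →
    (∀ t → wife (punchIn j t) ≡ punchIn w (wife′ t)) →
    ∀ fuel v (w≢v : w ≢ v) → requests wife M fuel v ≡ requests wife′ M′ fuel (punchOut w≢v)
  requests-relabel inj Mj≡w M∘punchIn wife∘punchIn zero v w≢v = refl
  requests-relabel {wife = wife} {M} {wife′} {M′} {j} {w} inj Mj≡w M∘punchIn wife∘punchIn (suc fuel) v w≢v
    with any? (λ t → M t ≟ v) | any? (λ s → M′ s ≟ punchOut w≢v)
  ... | yes (t , Mt≡v) | yes (s , M′s≡v′) = cong suc (begin
    requests wife M fuel (wife t)              ≡⟨ cong (requests wife M fuel ∘ wife) t≡punchIn-s ⟩
    requests wife M fuel (wife (punchIn j s))  ≡⟨ requests-relabel inj Mj≡w M∘punchIn wife∘punchIn fuel _ w≢wife ⟩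
    requests wife′ M′ fuel (punchOut w≢wife)   ≡⟨ cong (requests wife′ M′ fuel) punchOut-wife ⟩
    requests wife′ M′ fuel (wife′ s)           ∎)
    where
    open ≡-Reasoning
    t≡punchIn-s : t ≡ punchIn j s
    t≡punchIn-s = inj (trans Mt≡v (sym (trans (M∘punchIn s)
                    (trans (cong (punchIn w) M′s≡v′) (punchIn-punchOut w≢v)))))
    w≢wife : w ≢ wife (punchIn j s)
    w≢wife eq = punchInᵢ≢i w (wife′ s) (sym (trans eq (wife∘punchIn s)))
    punchOut-wife : punchOut w≢wife ≡ wife′ s
    punchOut-wife = trans (punchOut-cong w (wife∘punchIn s)) (punchOut-punchIn w)
  ... | yes (t , Mt≡v) | no ¬hit′ = contradiction (punchOut j≢t , M′s≡v′) ¬hit′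
    where
    j≢t : j ≢ t
    j≢t j≡t = w≢v (trans (sym Mj≡w) (trans (cong M j≡t) Mt≡v))
    M′s≡v′ : M′ (punchOut j≢t) ≡ punchOut w≢v
    M′s≡v′ = punchIn-injective w _ _ (trans (sym (M∘punchIn _))
               (trans (cong M (punchIn-punchOut j≢t)) (trans Mt≡v (sym (punchIn-punchOut w≢v)))))
  ... | no ¬hit | yes (s , M′s≡v′) =
    contradiction (punchIn j s , trans (M∘punchIn s) (trans (cong (punchIn w) M′s≡v′) (punchIn-punchOut w≢v))) ¬hit
  ... | no _ | no _ = refl

  𝟙-suc≟suc : ∀ r i → 𝟙 (suc r ℕ.≟ suc i) ≡ 𝟙 (r ℕ.≟ i)
  𝟙-suc≟suc r i = 𝟙-cong (mk⇔ suc-injective (cong suc)) (suc r ℕ.≟ suc i) (r ℕ.≟ i)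

  -- wife′ j and w′ j describe the household left after deleting man j and woman w; w′ j is the
  -- wife of man j, who is asked next when w is his mistress.
  module Relabel {a m} (wife : Fin (suc a) → Fin (suc m)) (w : Fin (suc m)) (w∉ : ∀ k → wife k ≢ w) where

    w≢wife : ∀ k → w ≢ wife k
    w≢wife k = w∉ k ∘ sym

    module _ (j : Fin (suc a)) where

      wife′ : Fin a → Fin m
      wife′ t = punchOut (w≢wife (punchIn j t))

      w′ : Fin m
      w′ = punchOut (w≢wife j)

      wife∘punchIn : ∀ t → wife (punchIn j t) ≡ punchIn w (wife′ t)
      wife∘punchIn t = sym (punchIn-punchOut (w≢wife (punchIn j t)))

      requests-insertAt : ∀ {u : Vec (Fin m) a} → Injective _≡_ _≡_ (lookup u) → ∀ fuel →
                          requests wife (lookup (insertAt (map (punchIn w) u) j w)) (suc fuel) w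
                          ≡ suc (requests wife′ (lookup u) fuel w′)
      requests-insertAt {u} u-inj fuel = begin
        requests wife M (suc fuel) w             ≡⟨ requests-hit wife fuel M-injective (insertAt-lookup pu j w) ⟩
        suc (requests wife M fuel (wife j))      ≡⟨ cong suc (requests-relabel M-injective (insertAt-lookup pu j w)
                                                      M∘punchIn wife∘punchIn fuel (wife j) (w≢wife j)) ⟩
        suc (requests wife′ (lookup u) fuel w′)  ∎
        where
        open ≡-Reasoning
        pu : Vec (Fin (suc m)) a
        pu = map (punchIn w) u
        M : Fin (suc a) → Fin (suc m)
        M = lookup (insertAt pu j w)
        M∘punchIn : ∀ t → M (punchIn j t) ≡ punchIn w (lookup u t)
        M∘punchIn t = trans (insertAt-punchIn pu j w t) (lookup-map t (punchIn w) u)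
        M-injective : Injective _≡_ _≡_ M
        M-injective = Equivalence.from (injective-insertAt pu j w)
          (punchIn-avoids u w , Equivalence.from (injective-map u (punchIn-injective w _ _)) u-inj)

      module _ (inj : Injective _≡_ _≡_ wife) where

        wife′-injective : Injective _≡_ _≡_ wife′
        wife′-injective eq = punchIn-injective j _ _ (inj (punchOut-injective (w≢wife _) (w≢wife _) eq))

        w′∉ : ∀ t → wife′ t ≢ w′
        w′∉ t eq = punchInᵢ≢i j t (inj (punchOut-injective (w≢wife _) (w≢wife j) eq))

    requests-first-step : ∀ fuel i →
      ∑ⁱ (suc a) (λ v → 𝟙 (requests wife (lookup v) (suc fuel) w ℕ.≟ suc i))
      ≡ ∑ⁱ (suc a) {m} (λ _ → 𝟙 (1 ℕ.≟ suc i))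
        + ∑[ j < suc a ] ∑ⁱ a (λ u → 𝟙 (requests (wife′ j) (lookup u) fuel (w′ j) ℕ.≟ i))
    requests-first-step fuel i = trans (∑ⁱ-split a w φ) (cong₂ _+_
      (∑ⁱ-cong (suc a) λ u _ → cong (λ r → 𝟙 (r ℕ.≟ suc i)) (requests-avoid wife fuel (punchIn-avoids u w)))
      (sum-cong-≗ {suc a} λ j → ∑ⁱ-cong a λ u u-inj →
         trans (cong (λ r → 𝟙 (r ℕ.≟ suc i)) (requests-insertAt j {u} u-inj fuel)) (𝟙-suc≟suc _ i)))
      where
      φ : Vec (Fin (suc m)) (suc a) → ℕ
      φ v = 𝟙 (requests wife (lookup v) (suc fuel) w ℕ.≟ suc i)

  count-requests : ∀ {a m} (wife : Fin a → Fin m) → Injective _≡_ _≡_ wife → (w : Fin m) → (∀ j → wife j ≢ w) →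
    ∀ fuel → a < fuel → ∀ i →
    ∑ⁱ a (λ v → 𝟙 (requests wife (lookup v) fuel w ℕ.≟ suc i)) ≡ a P′ i * (m ∸ suc i) P′ (a ∸ i)
  count-requests {zero} {m} wife _ w _ (suc fuel) _ i = trans
    (cong₂ _*_ (𝟙-yes (injective? (lookup {A = Fin m} [])) injective-[])
               (cong (λ r → 𝟙 (r ℕ.≟ suc i)) (requests-avoid wife {lookup {A = Fin m} []} {w} fuel λ ())))
    (one-request i)
    where
    one-request : ∀ i → 1 * 𝟙 (1 ℕ.≟ suc i) ≡ 0 P′ i * (m ∸ suc i) P′ (0 ∸ i)
    one-request zero    = refl
    one-request (suc i) = cong (λ z → z * 0 P′ i * 1) (sym (0∸n≡0 i))
  count-requests {suc a} {zero} wife _ () _ _ _ _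
  count-requests {suc a} {suc m} wife inj w w∉ (suc fuel@(suc _)) _ zero = begin
    ∑ⁱ (suc a) (λ v → 𝟙 (requests wife (lookup v) (suc fuel) w ℕ.≟ 1))
      ≡⟨ requests-first-step fuel 0 ⟩
    ∑ⁱ (suc a) {m} (λ _ → 1) + ∑[ j < suc a ] ∑ⁱ a (λ u → 𝟙 (requests (wife′ j) (lookup u) fuel (w′ j) ℕ.≟ 0))
      ≡⟨ cong₂ _+_ (count-injective (suc a) m) (sum-cong-≗ {suc a} λ j → trans
           (∑ⁱ-cong a λ u _ → 𝟙-no (requests (wife′ j) (lookup u) fuel (w′ j) ℕ.≟ 0)
                                    (requests-suc≢0 (wife′ j) (lookup u) _ (w′ j)))
           (∑ⁱ-zero a)) ⟩
    m P′ suc a + ∑[ j < suc a ] 0   ≡⟨ cong (m P′ suc a +_) (sum-replicate-zero (suc a)) ⟩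
    m P′ suc a + 0                  ≡⟨ +-identityʳ _ ⟩
    m P′ suc a                      ≡⟨ *-identityˡ _ ⟨
    1 * m P′ suc a                  ∎
    where
    open ≡-Reasoning
    open Relabel wife w w∉
  count-requests {suc a} {suc m} wife inj w w∉ (suc fuel) (s≤s a<fuel) (suc i) = begin
    ∑ⁱ (suc a) (λ v → 𝟙 (requests wife (lookup v) (suc fuel) w ℕ.≟ suc (suc i)))
      ≡⟨ requests-first-step fuel (suc i) ⟩
    ∑ⁱ (suc a) {m} (λ _ → 0) + ∑[ j < suc a ] ∑ⁱ a (λ u → 𝟙 (requests (wife′ j) (lookup u) fuel (w′ j) ℕ.≟ suc i))
      ≡⟨ cong₂ _+_ (∑ⁱ-zero (suc a) {m}) (sum-cong-≗ {suc a} λ j →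
           count-requests (wife′ j) (wife′-injective j inj) (w′ j) (w′∉ j inj) fuel a<fuel i) ⟩
    ∑[ j < suc a ] (a P′ i * (m ∸ suc i) P′ (a ∸ i))  ≡⟨ ∑-const (suc a) _ ⟩
    suc a * (a P′ i * (m ∸ suc i) P′ (a ∸ i))        ≡⟨ *-assoc (suc a) (a P′ i) _ ⟨
    suc a * a P′ i * (m ∸ suc i) P′ (a ∸ i)          ≡⟨ cong (_* (m ∸ suc i) P′ (a ∸ i)) (P′-suc a i) ⟨
    suc a P′ suc i * (m ∸ suc i) P′ (a ∸ i)          ∎
    where
    open ≡-Reasoning
    open Relabel wife w w∉

  faithfulFirst∉ : ∀ c f j → j ↑ˡ suc f ≢ faithfulFirst c f
  faithfulFirst∉ c f j eq =
    <-irrefl (trans (sym (toℕ-↑ˡ j (suc f))) (trans (cong toℕ eq) (toℕ-fromℕ< _))) (toℕ<n j)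

  count-R : ∀ c f j → List.length (List.filter (λ M → R c f M ℕ.≟ suc j) (injections c (suc f)))
                      ≡ c P′ j * (c + suc f ∸ suc j) P′ (c ∸ j)
  count-R c f j = begin
    List.length (List.filter R≟ (List.filter injective? (allFuns c n)))
      ≡⟨ length-filter≡∑𝟙 R≟ (List.filter injective? (allFuns c n)) ⟩
    ∑ˡ (List.map (𝟙 ∘ R≟) (List.filter injective? (allFuns c n)))
      ≡⟨ ∑ˡ-injections c n (𝟙 ∘ R≟) (λ inj g≗h → cong (λ r → 𝟙 (r ℕ.≟ suc j)) (R-cong inj g≗h)) ⟩
    ∑ⁱ c (λ v → 𝟙 (R c f (lookup v) ℕ.≟ suc j))
      ≡⟨ ∑ⁱ-cong c (λ v _ → cong (λ r → 𝟙 (r ℕ.≟ suc j)) (R≡requests (lookup v))) ⟩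
    ∑ⁱ c (λ v → 𝟙 (requests (_↑ˡ suc f) (lookup v) (suc n) (faithfulFirst c f) ℕ.≟ suc j))
      ≡⟨ count-requests (_↑ˡ suc f) (↑ˡ-injective (suc f) _ _) (faithfulFirst c f) (faithfulFirst∉ c f)
                        (suc n) (s≤s (m≤m+n c (suc f))) j ⟩
    c P′ j * (n ∸ suc j) P′ (c ∸ j)
      ∎
    where
    open ≡-Reasoning
    n : ℕ
    n = c + suc f
    R≟ : ∀ M → Dec (R c f M ≡ suc j)
    R≟ M = R c f M ℕ.≟ suc j
    R≡requests : ∀ M → R c f M ≡ requests (_↑ˡ suc f) M (suc n) (faithfulFirst c f)
    R≡requests M = requestsFrom≡requests M (suc n) (faithfulFirst c f)
    R-cong : ∀ {g h} → Injective _≡_ _≡_ g → g ≗ h → R c f g ≡ R c f h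
    R-cong {g} {h} inj g≗h = trans (R≡requests g)
      (trans (requests-cong (_↑ˡ suc f) inj g≗h (suc n) (faithfulFirst c f)) (sym (R≡requests h)))

  count-injections : ∀ c f → List.length (injections c f) ≡ (c + f) P′ c
  count-injections c f = begin
    List.length (List.filter injective? (allFuns c (c + f)))
      ≡⟨ length-filter≡∑𝟙 injective? (allFuns c (c + f)) ⟩
    ∑ˡ (List.map (𝟙 ∘ injective?) (allFuns c (c + f)))
      ≡⟨ ∑ˡ-allFuns c (c + f) (𝟙 ∘ injective?) (λ {g} {h} g≗h →
           𝟙-cong (injective-cong g≗h) (injective? g) (injective? h)) ⟩
    ∑ᵛ c (λ v → 𝟙 (injective? (lookup v)))
      ≡⟨ ∑ᵛ-cong c (λ v → sym (*-identityʳ _)) ⟩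
    ∑ⁱ c (λ _ → 1)
      ≡⟨ count-injective c (c + f) ⟩
    (c + f) P′ c
      ∎
    where open ≡-Reasoning

module Asymptotics where

  open import Data.Nat using (ℕ; zero; suc; _+_; _*_; _∸_; _^_; _≤_; _<_; s≤s; z≤n; NonZero; >-nonZero; ∣_-_∣)
  open import Data.Nat.Properties
  open import Data.Nat.Tactic.RingSolver using (solve-∀)
  open import Algebra.Properties.CommutativeSemigroup *-commutativeSemigroup using (x∙yz≈y∙xz)
  open import Data.Sum using ([_,_]′)
  open import Relation.Binary.PropositionalEquality
  open FallingFactorial

  ^-distribʳ-* : ∀ m n o → (m * n) ^ o ≡ m ^ o * n ^ o
  ^-distribʳ-* m n zero    = refl
  ^-distribʳ-* m n (suc o) = trans (cong (m * n *_) (^-distribʳ-* m n o)) (interchange m n (m ^ o) (n ^ o))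
    where
    interchange : ∀ w x y z → w * x * (y * z) ≡ w * y * (x * z)
    interchange = solve-∀

  n<m+o⇒n∸m<o : ∀ {m n o} → m ≤ n → n < m + o → n ∸ m < o
  n<m+o⇒n∸m<o {m} {n} {o} m≤n n<m+o = +-cancelˡ-< m (n ∸ m) o (subst (_< m + o) (sym (m+[n∸m]≡n m≤n)) n<m+o)

  ∣m-n∣<o : ∀ {m n o} → m < n + o → n < m + o → ∣ m - n ∣ < o
  ∣m-n∣<o {m} {n} {o} m<n+o n<m+o =
    [ (λ m≤n → subst (_< o) (sym (m≤n⇒∣m-n∣≡n∸m m≤n)) (n<m+o⇒n∸m<o m≤n n<m+o))
    , (λ n≤m → subst (_< o) (sym (m≤n⇒∣n-m∣≡n∸m n≤m)) (n<m+o⇒n∸m<o n≤m m<n+o))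
    ]′ (≤-total m n)

  -- With c = k x cheating and x faithful men, A / B is the exact Pr(R = j + 1) and C / D is
  -- its limit k^j / (k + 1)^(j + 1).
  module Estimate (k x j q : ℕ) where

    c b A B C D P : ℕ
    c = k * x
    b = c + x
    A = c P′ j * x
    B = b P′ suc j
    C = k ^ j
    D = suc k ^ suc j
    P = b P′ j

    C≤D : C ≤ D
    C≤D = ≤-trans (^-monoˡ-≤ j (n≤1+n k)) (m≤n*m (suc k ^ j) (suc k))

    upper : j * q + j < x → A * D * q < C * B * q + B * D
    upper jq+j<x = begin-strict
      A * D * q                    ≤⟨ *-monoˡ-≤ q AD≤ ⟩
      (C * B + j * (C * P)) * q    ≡⟨ expand C B j P q ⟩
      C * B * q + j * q * (C * P)  <⟨ +-monoʳ-< (C * B * q) error< ⟩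
      C * B * q + B * D            ∎
      where
      open ≤-Reasoning
      expand : ∀ C B j P q → (C * B + j * (C * P)) * q ≡ C * B * q + j * q * (C * P)
      expand = solve-∀
      regroup : ∀ a x s t → a * x * (s * t) ≡ x * s * (a * t)
      regroup = solve-∀
      c*suc-k≡k*b : ∀ k x → k * x * suc k ≡ k * (k * x + x)
      c*suc-k≡k*b = solve-∀
      c/b≤k/suc-k : c * suc k ≤ k * b
      c/b≤k/suc-k = ≤-reflexive (c*suc-k≡k*b k x)
      x*suc-k : ∀ x k C P → x * suc k * (C * P) ≡ C * ((k * x + x) * P)
      x*suc-k = solve-∀
      AD≤ : A * D ≤ C * B + j * (C * P)
      AD≤ = begin
        c P′ j * x * (suc k * suc k ^ j)  ≡⟨ regroup (c P′ j) x (suc k) (suc k ^ j) ⟩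
        x * suc k * (c P′ j * suc k ^ j)  ≤⟨ *-monoʳ-≤ (x * suc k) (P′-ratio j (n≤1+n k) c/b≤k/suc-k) ⟩
        x * suc k * (C * P)               ≡⟨ x*suc-k x k C P ⟩
        C * (b * P)                       ≤⟨ *-monoʳ-≤ C (*P′≤P′-suc+ b j) ⟩
        C * (B + j * P)                   ≡⟨ *-distribˡ-+ C B (j * P) ⟩
        C * B + C * (j * P)               ≡⟨ cong (C * B +_) (x∙yz≈y∙xz C j P) ⟩
        C * B + j * (C * P)               ∎
      x≤b : x ≤ b
      x≤b = m≤n+m x c
      error< : j * q * (C * P) < B * D
      error< = begin-strict
        j * q * (C * P)    ≤⟨ *-monoʳ-≤ (j * q) (*-monoˡ-≤ P C≤D) ⟩
        j * q * (D * P)    <⟨ *-monoˡ-< (D * P) {{DP≢0}} jq<b∸j ⟩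
        (b ∸ j) * (D * P)  ≡⟨ x∙yz≈y∙xz (b ∸ j) D P ⟩
        D * B              ≡⟨ *-comm D B ⟩
        B * D              ∎
        where
        jq<b∸j : j * q < b ∸ j
        jq<b∸j = m+n≤o⇒m≤o∸n (suc (j * q)) (≤-trans jq+j<x x≤b)
        j≤b : j ≤ b
        j≤b = ≤-trans (m≤n+m j (j * q)) (<⇒≤ (≤-trans jq+j<x x≤b))
        DP≢0 : NonZero (D * P)
        DP≢0 = m*n≢0 D P {{m^n≢0 (suc k) (suc j)}} {{>-nonZero (P′>0 j≤b)}}

    lower : 0 < k → j * j * q < x → j < x → C * B * q < A * D * q + B * D
    lower k>0 jjq<x j<x = *-cancelˡ-< c (C * B * q) (A * D * q + B * D) (begin-strict
      c * (C * B * q)                               ≤⟨ *-monoʳ-≤ c (*-monoˡ-≤ q (*-monoʳ-≤ C (P′≤^ b (suc j)))) ⟩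
      c * (C * b ^ suc j * q)                       ≡⟨ cong (λ z → c * (z * q)) C*b^≡ ⟩
      c * (x * D * c ^ j * q)                       ≡⟨ regroup c x D (c ^ j) q ⟩
      x * D * q * (c ^ j * c)                       ≤⟨ *-monoʳ-≤ (x * D * q) (^*≤P′*+ c j) ⟩
      x * D * q * (c P′ j * c + j * j * c ^ j)      ≡⟨ expand x D q (c P′ j) c j (c ^ j) ⟩
      c * (A * D * q) + x * (j * j * q) * (c ^ j * D) <⟨ +-monoʳ-< (c * (A * D * q)) error< ⟩
      c * (A * D * q) + c * (B * D)                 ≡⟨ *-distribˡ-+ c (A * D * q) (B * D) ⟨
      c * (A * D * q + B * D)                       ∎)
      where
      open ≤-Reasoning
      instance
        k≢0 : NonZero k
        k≢0 = >-nonZero k>0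
        x≢0 : NonZero x
        x≢0 = >-nonZero (≤-trans (s≤s z≤n) j<x)
      regroup : ∀ c x D X q → c * (x * D * X * q) ≡ x * D * q * (X * c)
      regroup = solve-∀
      expand : ∀ x D q p c j X → x * D * q * (p * c + j * j * X) ≡ c * (p * x * D * q) + x * (j * j * q) * (X * D)
      expand = solve-∀
      C*b^≡ : C * b ^ suc j ≡ x * D * c ^ j
      C*b^≡ = begin-equality
        k ^ j * (k * x + x) ^ suc j   ≡⟨ cong (λ z → k ^ j * z ^ suc j) (factor k x) ⟩
        k ^ j * (suc k * x) ^ suc j   ≡⟨ cong (k ^ j *_) (^-distribʳ-* (suc k) x (suc j)) ⟩
        k ^ j * (D * (x * x ^ j))     ≡⟨ regroup′ (k ^ j) D x (x ^ j) ⟩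
        x * D * (k ^ j * x ^ j)       ≡⟨ cong (x * D *_) (^-distribʳ-* k x j) ⟨
        x * D * (k * x) ^ j           ∎
        where
        factor : ∀ k x → k * x + x ≡ suc k * x
        factor = solve-∀
        regroup′ : ∀ K D x X → K * (D * (x * X)) ≡ x * D * (K * X)
        regroup′ = solve-∀
      error< : x * (j * j * q) * (c ^ j * D) < c * (B * D)
      error< = begin-strict
        x * (j * j * q) * (c ^ j * D)  <⟨ *-monoˡ-< (c ^ j * D) {{c^jD≢0}} (*-monoʳ-< x jjq<x) ⟩
        x * x * (c ^ j * D)            ≤⟨ *-monoˡ-≤ (c ^ j * D) (*-mono-≤ x≤c x≤c) ⟩
        c * c * (c ^ j * D)            ≡⟨ regroup″ c (c ^ j) D ⟩
        c * (c ^ suc j * D)            ≤⟨ *-monoʳ-≤ c (*-monoˡ-≤ D c^suc-j≤B) ⟩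
        c * (B * D)                    ∎
        where
        x≤c : x ≤ c
        x≤c = m≤n*m x k
        c^jD≢0 : NonZero (c ^ j * D)
        c^jD≢0 = m*n≢0 (c ^ j) D {{m^n≢0 c j {{m*n≢0 k x}}}} {{m^n≢0 (suc k) (suc j)}}
        c^suc-j≤B : c ^ suc j ≤ B
        c^suc-j≤B = ≤-trans (^-monoˡ-≤ (suc j) (m+n≤o⇒m≤o∸n c (+-monoʳ-≤ c j<x))) (∸^≤P′ b (suc j))
        regroup″ : ∀ c X D → c * c * (X * D) ≡ c * (c * X * D)
        regroup″ = solve-∀

    close : 0 < k → j * j * q + (j * q + j) < x → ∣ A * D - C * B ∣ * q < B * D
    close k>0 N<x = subst (_< B * D) (sym (*-distribʳ-∣-∣ q (A * D) (C * B)))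
      (∣m-n∣<o (upper (≤-<-trans (m≤n+m (j * q + j) (j * j * q)) N<x))
            (lower k>0 (≤-<-trans (m≤m+n (j * j * q) (j * q + j)) N<x)
                       (≤-<-trans (≤-trans (m≤n+m j (j * q)) (m≤n+m (j * q + j) (j * j * q))) N<x)))

module Probability where

  open import Data.Nat as ℕ using (ℕ; zero; suc; _+_; _*_; _∸_; _^_; _≥_; NonZero; >-nonZero; s≤s; z≤n)
  open import Data.Nat.Properties as ℕ
    using (≤-total; m≤n⇒∣m-n∣≡n∸m; m≤n⇒∣n-m∣≡n∸m; *-monoˡ-≤; *-assoc; *-comm; m^n≢0; m+[n∸m]≡n; m+n∸m≡n;
           m≤n*m; ≤-trans; m≤n+m)
  open import Data.Integer as ℤ using (+_; -[1+_]; _⊖_)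
  import Data.Integer.Properties as ℤ
  open import Data.Rational using (ℚ; 0ℚ; mkℚ; _<_; _≤_; ∣_∣; _-_; _/_; fromℚᵘ; toℚᵘ; *<*)
  import Data.Rational as ℚ
  open import Data.Rational.Properties
    using (toℚᵘ-cancel-<; toℚᵘ-cancel-≤; toℚᵘ-homo-∣-∣; toℚᵘ-homo-+; toℚᵘ-homo‿-; toℚᵘ-fromℚᵘ; fromℚᵘ-cong;
           module ≤-Reasoning)
  open import Data.Rational.Unnormalised as ℚᵘ using (ℚᵘ; mkℚᵘ; *≡*; *≤*)
  import Data.Rational.Unnormalised.Properties as ℚᵘ
  open import Data.Product using (∃; _,_)
  open import Data.Sum using ([_,_]′)
  open import Relation.Binary.PropositionalEquality
  open import Defs using (ratio; ProbR; geomPMF)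
  open FallingFactorial
  open Requests using (count-R; count-injections)
  open Asymptotics using (module Estimate)

  ratio≡/ : ∀ a d .{{_ : NonZero d}} → ratio a d ≡ (+ a) / d
  ratio≡/ a (suc d) = refl

  ratio-cong : ∀ {a b c d} .{{_ : NonZero b}} .{{_ : NonZero d}} → a * d ≡ c * b → ratio a b ≡ ratio c d
  ratio-cong {a} {suc b} {c} {suc d} ad≡cb = fromℚᵘ-cong {mkℚᵘ (+ a) b} {mkℚᵘ (+ c) d}
    (*≡* (trans (sym (ℤ.pos-* a (suc d))) (trans (cong +_ ad≡cb) (ℤ.pos-* c (suc b)))))

  ∣⊖∣≡∣-∣ : ∀ m n → ℤ.∣ m ⊖ n ∣ ≡ ℕ.∣ m - n ∣
  ∣⊖∣≡∣-∣ m n = [ (λ m≤n → trans (ℤ.∣⊖∣-≤ m≤n) (sym (m≤n⇒∣m-n∣≡n∸m m≤n)))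
                , (λ n≤m → trans (ℤ.∣m⊖n∣≡∣n⊖m∣ m n) (trans (ℤ.∣⊖∣-≤ n≤m) (sym (m≤n⇒∣n-m∣≡n∸m n≤m))))
                ]′ (≤-total m n)

  -- Unnormalised rationals are used because there ∣ a/b − c/d ∣ reduces to ∣a d − c b∣ / (b d).
  ∣ratio-ratio∣<1/ : ∀ a b c d q .{{_ : NonZero b}} .{{_ : NonZero d}} .{{_ : NonZero q}} →
                     ℕ.∣ a * d - c * b ∣ * q ℕ.< b * d → ∣ ratio a b - ratio c d ∣ < ratio 1 q
  ∣ratio-ratio∣<1/ a b@(suc b′) c d@(suc d′) q@(suc q′) lt =
    toℚᵘ-cancel-< (ℚᵘ.<-respʳ-≃ (ℚᵘ.≃-sym (toℚᵘ-fromℚᵘ (mkℚᵘ (+ 1) q′)))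
                  (ℚᵘ.<-respˡ-≃ (ℚᵘ.≃-sym toℚᵘ-∣-∣) (ℚᵘ.*<* cross-multiplied)))
    where
    x y : ℚᵘ
    x = mkℚᵘ (+ a) b′
    y = mkℚᵘ (+ c) d′
    toℚᵘ-∣-∣ : toℚᵘ ∣ fromℚᵘ x - fromℚᵘ y ∣ ℚᵘ.≃ ℚᵘ.∣ x ℚᵘ.- y ∣
    toℚᵘ-∣-∣ = ℚᵘ.≃-trans (toℚᵘ-homo-∣-∣ (fromℚᵘ x - fromℚᵘ y)) (ℚᵘ.∣-∣-cong
      (ℚᵘ.≃-trans (toℚᵘ-homo-+ (fromℚᵘ x) (ℚ.- fromℚᵘ y))
        (ℚᵘ.+-cong (toℚᵘ-fromℚᵘ x) (ℚᵘ.≃-trans (toℚᵘ-homo‿- (fromℚᵘ y)) (ℚᵘ.-‿cong (toℚᵘ-fromℚᵘ y))))))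
    numerator : ℤ.∣ + a ℤ.* + d ℤ.+ (ℤ.- + c) ℤ.* + b ∣ ≡ ℕ.∣ a * d - c * b ∣
    numerator = trans (cong ℤ.∣_∣ (begin
      + a ℤ.* + d ℤ.+ (ℤ.- + c) ℤ.* + b  ≡⟨ cong₂ ℤ._+_ (ℤ.pos-* a d) (ℤ.neg-distribˡ-* (+ c) (+ b)) ⟨
      + (a * d) ℤ.+ ℤ.- (+ c ℤ.* + b)    ≡⟨ cong (λ z → + (a * d) ℤ.+ ℤ.- z) (ℤ.pos-* c b) ⟨
      + (a * d) ℤ.+ ℤ.- + (c * b)        ≡⟨ ℤ.m-n≡m⊖n (a * d) (c * b) ⟩
      (a * d) ⊖ (c * b)                  ∎)) (∣⊖∣≡∣-∣ (a * d) (c * b))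
      where open ≡-Reasoning
    cross-multiplied : + ℤ.∣ + a ℤ.* + d ℤ.+ (ℤ.- + c) ℤ.* + b ∣ ℤ.* + q ℤ.< + 1 ℤ.* + (b * d)
    cross-multiplied = subst₂ ℤ._<_
      (trans (ℤ.pos-* ℕ.∣ a * d - c * b ∣ q) (cong (λ n → + n ℤ.* + q) (sym numerator)))
      (sym (ℤ.*-identityˡ (+ (b * d))))
      (ℤ.+<+ lt)

  positive⇒1/n≤ : ∀ ε → 0ℚ < ε → ∃ λ n → ratio 1 (suc n) ≤ ε
  positive⇒1/n≤ (mkℚ (+ suc p) q _) _ = q , toℚᵘ-cancel-≤
    (ℚᵘ.≤-respˡ-≃ (ℚᵘ.≃-sym (toℚᵘ-fromℚᵘ (mkℚᵘ (+ 1) q)))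
                  (*≤* (ℤ.+≤+ (*-monoˡ-≤ (suc q) {1} {suc p} (s≤s z≤n)))))
  positive⇒1/n≤ (mkℚ (+ zero)  _ _) (*<* (ℤ.+<+ ()))
  positive⇒1/n≤ (mkℚ -[1+ _ ] _ _) (*<* ())

  ProbR-exact : ∀ c f′ j → j ℕ.≤ c → ProbR c f′ (suc j) ≡ ratio (c P′ j * suc f′) ((c + suc f′) P′ suc j)
  ProbR-exact c f′ j j≤c = begin
    ProbR c f′ (suc j)                                ≡⟨ cong₂ ratio (count-R c f′ j) (count-injections c (suc f′)) ⟩
    ratio (c P′ j * (n ∸ suc j) P′ (c ∸ j)) (n P′ c)  ≡⟨ ratio-cong cross ⟩
    ratio (c P′ j * suc f′) (n P′ suc j)              ∎
    where
    open ≡-Reasoning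
    n : ℕ
    n = c + suc f′
    instance
      n-P′-c≢0 : NonZero (n P′ c)
      n-P′-c≢0 = >-nonZero (P′>0 (ℕ.m≤m+n c (suc f′)))
      n-P′-suc-j≢0 : NonZero (n P′ suc j)
      n-P′-suc-j≢0 = >-nonZero (P′>0 (ℕ.≤-trans (s≤s j≤c) (ℕ.m<m+n c (s≤s z≤n))))
    cross : c P′ j * (n ∸ suc j) P′ (c ∸ j) * n P′ suc j ≡ c P′ j * suc f′ * n P′ c
    cross = begin
      c P′ j * (n ∸ suc j) P′ (c ∸ j) * n P′ suc j     ≡⟨ *-assoc (c P′ j) _ _ ⟩
      c P′ j * ((n ∸ suc j) P′ (c ∸ j) * n P′ suc j)   ≡⟨ cong (c P′ j *_) (*-comm _ (n P′ suc j)) ⟩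
      c P′ j * (n P′ suc j * (n ∸ suc j) P′ (c ∸ j))   ≡⟨ cong (c P′ j *_) (P′-+ n (suc j) (c ∸ j)) ⟨
      c P′ j * n P′ suc (j + (c ∸ j))                  ≡⟨ cong (λ l → c P′ j * n P′ suc l) (m+[n∸m]≡n j≤c) ⟩
      c P′ j * ((n ∸ c) * n P′ c)                      ≡⟨ cong (λ l → c P′ j * (l * n P′ c)) (m+n∸m≡n c (suc f′)) ⟩
      c P′ j * (suc f′ * n P′ c)                       ≡⟨ *-assoc (c P′ j) (suc f′) (n P′ c) ⟨
      c P′ j * suc f′ * n P′ c                         ∎

  geomPMF≡ratio : ∀ k j → geomPMF k (suc j) ≡ ratio (k ^ j) (suc k ^ suc j)
  geomPMF≡ratio k j = sym (ratio≡/ (k ^ j) (suc k ^ suc j) {{m^n≢0 (suc k) (suc j)}})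

  ProbR-close : ∀ k f′ j q → k ≥ 1 → f′ ≥ j * j * suc q + (j * suc q + j) →
                ∣ ProbR (k * suc f′) f′ (suc j) - geomPMF k (suc j) ∣ < ratio 1 (suc q)
  ProbR-close k f′ j q k≥1 f′≥N = begin-strict
    ∣ ProbR c f′ (suc j) - geomPMF k (suc j) ∣
      ≡⟨ cong₂ (λ p g → ∣ p - g ∣) (ProbR-exact c f′ j j≤c) (geomPMF≡ratio k j) ⟩
    ∣ ratio (c P′ j * x) ((c + x) P′ suc j) - ratio (k ^ j) (suc k ^ suc j) ∣
      <⟨ ∣ratio-ratio∣<1/ (c P′ j * x) ((c + x) P′ suc j) (k ^ j) (suc k ^ suc j) (suc q)
           (Estimate.close k x j (suc q) k≥1 (s≤s f′≥N)) ⟩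
    ratio 1 (suc q)
      ∎
    where
    open ≤-Reasoning
    x c : ℕ
    x = suc f′
    c = k * x
    j≤f′ : j ℕ.≤ f′
    j≤f′ = ℕ.≤-trans (m≤n+m j (j * suc q)) (ℕ.≤-trans (m≤n+m (j * suc q + j) (j * j * suc q)) f′≥N)
    j≤c : j ℕ.≤ c
    j≤c = ℕ.≤-trans j≤f′ (ℕ.≤-trans (ℕ.n≤1+n f′) (m≤n*m x k {{>-nonZero k≥1}}))
    instance
      B≢0 : NonZero ((c + x) P′ suc j)
      B≢0 = >-nonZero (P′>0 (ℕ.≤-trans (s≤s j≤f′) (m≤n+m x c)))
      D≢0 : NonZero (suc k ^ suc j)
      D≢0 = m^n≢0 (suc k) (suc j)

open import Defs
open import Data.Nat using (ℕ; zero; suc; _+_; _*_; _≥_)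
open import Data.Product using (∃; _,_)
open import Data.Rational using (ℚ; _-_; _<_; ∣_∣; 0ℚ)
open import Data.Rational.Properties using (<-≤-trans)
open Probability using (ProbR-close; positive⇒1/n≤)

mainTheorem4 : (k : ℕ) → k ≥ 1 → (i : ℕ) → i ≥ 1 →
    (ε : ℚ) → 0ℚ < ε →
    ∃ λ (N : ℕ) → (f′ : ℕ) → f′ ≥ N →
      ∣ ProbR (k * suc f′) f′ i - geomPMF k i ∣ < ε
mainTheorem4 k k≥1 zero    ()
mainTheorem4 k k≥1 (suc j) _  ε ε>0 =
  let (q , 1/q≤ε) = positive⇒1/n≤ ε ε>0
  in  j * j * suc q + (j * suc q + j) , λ f′ f′≥N → <-≤-trans (ProbR-close k f′ j q k≥1 f′≥N) 1/q≤ε
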